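{- There are infinitely many nonsquare powers $q$ of $2$ such that $\lfloor 2\sqrt{q}\rfloor\equiv1\pmod4$, and there are infinitely many nonsquare powers $q$ of $2$ such that $\lfloor 2\sqrt{q}\rfloor\equiv2\pmod4$. -}

module Defs where

open import Data.Nat using (ℕ; _+_; _*_; _^_; _≤_; _<_)
open import Data.Nat.DivMod using (_%_)
open import Data.Product using (Σ; ∃; _×_)
open import Relation.Binary.PropositionalEquality using (_≡_)
open import Relation.Nullary using (¬_)

IsPowerOfTwo : ℕ → Set
IsPowerOfTwo q = ∃ λ e → q ≡ 2 ^ e

IsSquare : ℕ → Set
IsSquare q = ∃ λ k → k * k ≡ q

-- m = ⌊ 2 √q ⌋ ; since 2√q = √(4q) ≥ 0, this is characterised by
-- m² ≤ 4q < (m+1)²  (the defining property of the floor).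
IsFloorTwoSqrt : ℕ → ℕ → Set
IsFloorTwoSqrt q m = (m * m ≤ 4 * q) × (4 * q < (m + 1) * (m + 1))

Infinite : (ℕ → Set) → Set
Infinite P = (N : ℕ) → ∃ λ q → (N ≤ q) × P q

Good : ℕ → ℕ → Set
Good r q = IsPowerOfTwo q × ¬ IsSquare q ×
           (∃ λ m → IsFloorTwoSqrt q m × m % 4 ≡ r)

{-# OPTIONS --safe #-}
-- The nonsquare powers of 2 are the numbers q = 2·4ⁿ, and ⌊2√q⌋ = ⌊2ⁿ⁺¹√2⌋ is the
-- integer formed by the binary digits of √2 up to position n + 1.  Its residue mod 4
-- is therefore the pair of digits at positions n and n + 1 read as a binary number,
-- so residues 1 and 2 are the digit patterns 01 and 10.  Both patterns occur beyond
-- any position because the digits are not eventually constant, which is a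
-- quantitative irrationality of √2: if ⌊s√n⌋ = s⌊√n⌋ for a nonsquare n, then
-- s²(⌊√n⌋² + 1) ≤ s²n < (s⌊√n⌋ + 1)² forces s ≤ 2⌊√n⌋, and symmetrically for a run
-- of ones; taking s = 2ᵐ⁺² and n = 2·4ᵐ rules out a run of m + 2 equal digits after
-- position m.
module Submission where

open import Data.Bool.Base using (Bool; true; false; not)
open import Data.Bool.Properties using (¬-not; not-involutive) renaming (_≟_ to _≟ᵇ_)
open import Data.Nat
open import Data.Nat.DivMod using (_%_; [m+kn]%n≡m%n)
open import Data.Nat.Divisibility using (divides; ∣1⇒≡1)
open import Data.Nat.Primality using (euclidsLemma; prime[2])
open import Data.Nat.Properties
open import Algebra.Properties.CommutativeSemigroup *-commutativeSemigroup
  using (x∙yz≈y∙xz; interchange)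
open import Data.Nat.Tactic.RingSolver using (solve-∀)
open import Function.Base using (_∘_)
open import Data.Product using (_×_; _,_; proj₁; proj₂; ∃)
open import Data.Sum using (_⊎_; inj₁; inj₂; reduce)
open import Relation.Binary.PropositionalEquality
open import Relation.Nullary using (¬_; yes; no; contradiction)
open import Relation.Unary using (Pred; Decidable)

open import Defs

IsFloorSqrt : ℕ → ℕ → Set
IsFloorSqrt n m = m * m ≤ n × n < suc m * suc m

floorSqrt : ∀ n → ∃ (IsFloorSqrt n)
floorSqrt zero = 0 , z≤n , s≤s z≤n
floorSqrt (suc n) with floorSqrt n
... | m , m²≤n , n<[1+m]² with suc n <? suc m * suc m
...   | yes 1+n<[1+m]² = m , m≤n⇒m≤1+n m²≤n , 1+n<[1+m]²
...   | no  1+n≮[1+m]² = suc m , ≮⇒≥ 1+n≮[1+m]² ,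
                         ≤-<-trans n<[1+m]² (*-mono-< (n<1+n (suc m)) (n<1+n (suc m)))

⌊√_⌋ : ℕ → ℕ
⌊√ n ⌋ = proj₁ (floorSqrt n)

⌊√n⌋²≤n : ∀ n → ⌊√ n ⌋ * ⌊√ n ⌋ ≤ n
⌊√n⌋²≤n n = proj₁ (proj₂ (floorSqrt n))

n<[1+⌊√n⌋]² : ∀ n → n < suc ⌊√ n ⌋ * suc ⌊√ n ⌋
n<[1+⌊√n⌋]² n = proj₂ (proj₂ (floorSqrt n))

m²<n²⇒m<n : ∀ {m n} → m * m < n * n → m < n
m²<n²⇒m<n m²<n² = ≰⇒> (λ n≤m → <⇒≱ m²<n² (*-mono-≤ n≤m n≤m))

m²≤n⇒m≤⌊√n⌋ : ∀ {m n} → m * m ≤ n → m ≤ ⌊√ n ⌋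
m²≤n⇒m≤⌊√n⌋ {n = n} m²≤n = ≤-pred (m²<n²⇒m<n (≤-<-trans m²≤n (n<[1+⌊√n⌋]² n)))

n<m²⇒⌊√n⌋<m : ∀ {m n} → n < m * m → ⌊√ n ⌋ < m
n<m²⇒⌊√n⌋<m {n = n} n<m² = m²<n²⇒m<n (≤-<-trans (⌊√n⌋²≤n n) n<m²)

[m*n]²≡m²*n² : ∀ m n → (m * n) * (m * n) ≡ m * m * (n * n)
[m*n]²≡m²*n² m n = interchange m n m n

[1+m]²≡1+2m+m² : ∀ m → suc m * suc m ≡ suc (2 * m) + m * m
[1+m]²≡1+2m+m² = solve-∀

2⌊√n⌋≤⌊√4n⌋ : ∀ n → 2 * ⌊√ n ⌋ ≤ ⌊√ (4 * n) ⌋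
2⌊√n⌋≤⌊√4n⌋ n = m²≤n⇒m≤⌊√n⌋
  (subst (_≤ 4 * n) (sym ([m*n]²≡m²*n² 2 ⌊√ n ⌋)) (*-monoʳ-≤ 4 (⌊√n⌋²≤n n)))

⌊√4n⌋<2+2⌊√n⌋ : ∀ n → ⌊√ (4 * n) ⌋ < 2 + 2 * ⌊√ n ⌋
⌊√4n⌋<2+2⌊√n⌋ n = subst (⌊√ (4 * n) ⌋ <_) (*-suc 2 ⌊√ n ⌋) (n<m²⇒⌊√n⌋<m
  (subst (4 * n <_) (sym ([m*n]²≡m²*n² 2 (suc ⌊√ n ⌋))) (*-monoʳ-< 4 (n<[1+⌊√n⌋]² n))))

bitValue : Bool → ℕ
bitValue false = 0
bitValue true  = 1

⌊√4n⌋≡bit+2⌊√n⌋ : ∀ n → ∃ λ d → ⌊√ (4 * n) ⌋ ≡ bitValue d + 2 * ⌊√ n ⌋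
⌊√4n⌋≡bit+2⌊√n⌋ n with m≤n⇒m<n∨m≡n (≤-pred (⌊√4n⌋<2+2⌊√n⌋ n))
... | inj₁ <1+2⌊√n⌋ = false , ≤-antisym (≤-pred <1+2⌊√n⌋) (2⌊√n⌋≤⌊√4n⌋ n)
... | inj₂ ≡1+2⌊√n⌋ = true , ≡1+2⌊√n⌋

⌊√s²n⌋≡s⌊√n⌋⇒s≤2⌊√n⌋ : ∀ s n → ¬ IsSquare n → ⌊√ (s * s * n) ⌋ ≡ s * ⌊√ n ⌋ → s ≤ 2 * ⌊√ n ⌋
⌊√s²n⌋≡s⌊√n⌋⇒s≤2⌊√n⌋ zero n _ _ = z≤n
⌊√s²n⌋≡s⌊√n⌋⇒s≤2⌊√n⌋ s@(suc _) n n-nonSquare eq =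
  *-cancelˡ-≤ s (≤-pred (+-cancelʳ-< (s * s * (a * a)) (s * s) _ s²+s²a²<1+2sa+s²a²))
  where
  open ≤-Reasoning
  a = ⌊√ n ⌋
  b = ⌊√ (s * s * n) ⌋
  a²<n : a * a < n
  a²<n = ≤∧≢⇒< (⌊√n⌋²≤n n) (λ a²≡n → n-nonSquare (a , a²≡n))
  s²+s²a²<1+2sa+s²a² : s * s + s * s * (a * a) < suc (s * (2 * a)) + s * s * (a * a)
  s²+s²a²<1+2sa+s²a² = begin-strict
    s * s + s * s * (a * a)              ≡⟨ *-suc (s * s) (a * a) ⟨
    s * s * suc (a * a)                  ≤⟨ *-monoʳ-≤ (s * s) a²<n ⟩
    s * s * n                            <⟨ n<[1+⌊√n⌋]² (s * s * n) ⟩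
    suc b * suc b                        ≡⟨ [1+m]²≡1+2m+m² b ⟩
    suc (2 * b) + b * b                  ≡⟨ cong (λ m → suc (2 * m) + m * m) eq ⟩
    suc (2 * (s * a)) + (s * a) * (s * a) ≡⟨ cong₂ _+_ (cong suc (x∙yz≈y∙xz 2 s a)) ([m*n]²≡m²*n² s a) ⟩
    suc (s * (2 * a)) + s * s * (a * a)  ∎

1+⌊√s²n⌋≡s[1+⌊√n⌋]⇒s<2[1+⌊√n⌋] : ∀ s n → suc ⌊√ (s * s * n) ⌋ ≡ s * suc ⌊√ n ⌋ →
                                   s < 2 * suc ⌊√ n ⌋
1+⌊√s²n⌋≡s[1+⌊√n⌋]⇒s<2[1+⌊√n⌋] s n eq = *-cancelˡ-< s s (2 * suc a) (begin-strict
    s * s            ≤⟨ +-cancelʳ-≤ (s * s * n) (s * s) _ s²+s²n≤1+2b+s²n ⟩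
    suc (2 * b)      <⟨ n<1+n (suc (2 * b)) ⟩
    2 + 2 * b        ≡⟨ *-suc 2 b ⟨
    2 * suc b        ≡⟨ cong (2 *_) eq ⟩
    2 * (s * suc a)  ≡⟨ x∙yz≈y∙xz 2 s (suc a) ⟩
    s * (2 * suc a)  ∎)
  where
  open ≤-Reasoning
  a = ⌊√ n ⌋
  b = ⌊√ (s * s * n) ⌋
  s²+s²n≤1+2b+s²n : s * s + s * s * n ≤ suc (2 * b) + s * s * n
  s²+s²n≤1+2b+s²n = begin
    s * s + s * s * n          ≡⟨ *-suc (s * s) n ⟨
    s * s * suc n              ≤⟨ *-monoʳ-≤ (s * s) (n<[1+⌊√n⌋]² n) ⟩
    s * s * (suc a * suc a)    ≡⟨ [m*n]²≡m²*n² s (suc a) ⟨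
    (s * suc a) * (s * suc a)  ≡⟨ cong (λ m → m * m) eq ⟨
    suc b * suc b              ≡⟨ [1+m]²≡1+2m+m² b ⟩
    suc (2 * b) + b * b        ≤⟨ +-monoʳ-≤ (suc (2 * b)) (⌊√n⌋²≤n (s * s * n)) ⟩
    suc (2 * b) + s * s * n    ∎

mutual
  2*4^n-nonSquare : ∀ n → ¬ IsSquare (2 * 4 ^ n)
  2*4^n-nonSquare n (m , m²≡2*4^n)
    with reduce (euclidsLemma m m prime[2] (divides (4 ^ n) (trans m²≡2*4^n (*-comm 2 (4 ^ n)))))
  ... | divides k refl = 2*m²≢4^n n k (*-cancelˡ-≡ _ _ 2 (trans (sym ([k*2]²≡2*[2*k²] k)) m²≡2*4^n))
    where
    [k*2]²≡2*[2*k²] : ∀ k → (k * 2) * (k * 2) ≡ 2 * (2 * (k * k))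
    [k*2]²≡2*[2*k²] = solve-∀

  2*m²≢4^n : ∀ n m → 2 * (m * m) ≢ 4 ^ n
  2*m²≢4^n zero m 2m²≡1 with ∣1⇒≡1 (divides (m * m) (trans (sym 2m²≡1) (*-comm 2 (m * m))))
  ... | ()
  2*m²≢4^n (suc n) m 2m²≡4*4^n =
    2*4^n-nonSquare n (m , *-cancelˡ-≡ _ _ 2 (trans 2m²≡4*4^n (*-assoc 2 2 (4 ^ n))))

4^n≡2^n*2^n : ∀ n → 4 ^ n ≡ 2 ^ n * 2 ^ n
4^n≡2^n*2^n zero = refl
4^n≡2^n*2^n (suc n) = trans (cong (4 *_) (4^n≡2^n*2^n n)) (sym ([m*n]²≡m²*n² 2 (2 ^ n)))

2*4^[1+n]≡4*[2*4^n] : ∀ n → 2 * 4 ^ suc n ≡ 4 * (2 * 4 ^ n)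
2*4^[1+n]≡4*[2*4^n] n = x∙yz≈y∙xz 2 4 (4 ^ n)

2*4^[k+n]≡[2^k]²*[2*4^n] : ∀ k n → 2 * 4 ^ (k + n) ≡ 2 ^ k * 2 ^ k * (2 * 4 ^ n)
2*4^[k+n]≡[2^k]²*[2*4^n] k n = begin
  2 * 4 ^ (k + n)              ≡⟨ cong (2 *_) (^-distribˡ-+-* 4 k n) ⟩
  2 * (4 ^ k * 4 ^ n)          ≡⟨ cong (λ m → 2 * (m * 4 ^ n)) (4^n≡2^n*2^n k) ⟩
  2 * (2 ^ k * 2 ^ k * 4 ^ n)  ≡⟨ x∙yz≈y∙xz 2 (2 ^ k * 2 ^ k) (4 ^ n) ⟩
  2 ^ k * 2 ^ k * (2 * 4 ^ n)  ∎
  where open ≡-Reasoning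

⌊2^_√2⌋ : ℕ → ℕ
⌊2^ n √2⌋ = ⌊√ (2 * 4 ^ n) ⌋

⌊2^n√2⌋<2^[1+n] : ∀ n → ⌊2^ n √2⌋ < 2 ^ suc n
⌊2^n√2⌋<2^[1+n] n = n<m²⇒⌊√n⌋<m (begin-strict
  2 * 4 ^ n                    <⟨ *-monoˡ-< (4 ^ n) {{m^n≢0 4 n}} (m<m+n 2 {2} z<s) ⟩
  4 * 4 ^ n                    ≡⟨ cong (4 *_) (4^n≡2^n*2^n n) ⟩
  4 * (2 ^ n * 2 ^ n)          ≡⟨ [m*n]²≡m²*n² 2 (2 ^ n) ⟨
  2 ^ suc n * 2 ^ suc n        ∎)
  where open ≤-Reasoning

√2-bit : ℕ → Bool
√2-bit n = proj₁ (⌊√4n⌋≡bit+2⌊√n⌋ (2 * 4 ^ n))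

⌊2^[1+n]√2⌋≡bit+2⌊2^n√2⌋ : ∀ n → ⌊2^ suc n √2⌋ ≡ bitValue (√2-bit n) + 2 * ⌊2^ n √2⌋
⌊2^[1+n]√2⌋≡bit+2⌊2^n√2⌋ n =
  trans (cong ⌊√_⌋ (2*4^[1+n]≡4*[2*4^n] n)) (proj₂ (⌊√4n⌋≡bit+2⌊√n⌋ (2 * 4 ^ n)))

⌊2^[2+n]√2⌋%4 : ∀ n → ⌊2^ 2 + n √2⌋ % 4 ≡ (2 * bitValue (√2-bit n) + bitValue (√2-bit (suc n))) % 4
⌊2^[2+n]√2⌋%4 n = begin
  ⌊2^ 2 + n √2⌋ % 4             ≡⟨ cong (_% 4) (trans (⌊2^[1+n]√2⌋≡bit+2⌊2^n√2⌋ (suc n))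
                                     (cong (λ m → d₁ + 2 * m) (⌊2^[1+n]√2⌋≡bit+2⌊2^n√2⌋ n))) ⟩
  (d₁ + 2 * (d₀ + 2 * x)) % 4   ≡⟨ cong (_% 4) (binary-expansion d₀ d₁ x) ⟩
  (2 * d₀ + d₁ + x * 4) % 4     ≡⟨ [m+kn]%n≡m%n (2 * d₀ + d₁) x 4 ⟩
  (2 * d₀ + d₁) % 4             ∎
  where
  open ≡-Reasoning
  x  = ⌊2^ n √2⌋
  d₀ = bitValue (√2-bit n)
  d₁ = bitValue (√2-bit (suc n))
  binary-expansion : ∀ d₀ d₁ x → d₁ + 2 * (d₀ + 2 * x) ≡ 2 * d₀ + d₁ + x * 4
  binary-expansion = solve-∀

√2-bit-run : ∀ b m k → (∃ λ n → m ≤ n × √2-bit n ≢ b) ⊎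
                        bitValue b + ⌊2^ k + m √2⌋ ≡ 2 ^ k * (bitValue b + ⌊2^ m √2⌋)
√2-bit-run b m zero = inj₂ (sym (*-identityˡ _))
√2-bit-run b m (suc k) with √2-bit-run b m k | √2-bit (k + m) ≟ᵇ b
... | inj₁ change | _       = inj₁ change
... | inj₂ _      | no  ≢b = inj₁ (k + m , m≤n+m m k , ≢b)
... | inj₂ run    | yes ≡b = inj₂ (begin
  d + ⌊2^ suc k + m √2⌋                  ≡⟨ cong (d +_) (⌊2^[1+n]√2⌋≡bit+2⌊2^n√2⌋ (k + m)) ⟩
  d + (bitValue (√2-bit (k + m)) + 2 * x) ≡⟨ cong (λ b′ → d + (bitValue b′ + 2 * x)) ≡b ⟩
  d + (d + 2 * x)                         ≡⟨ double d x ⟩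
  2 * (d + x)                             ≡⟨ cong (2 *_) run ⟩
  2 * (2 ^ k * (d + ⌊2^ m √2⌋))           ≡⟨ *-assoc 2 (2 ^ k) _ ⟨
  2 ^ suc k * (d + ⌊2^ m √2⌋)             ∎)
  where
  open ≡-Reasoning
  d = bitValue b
  x = ⌊2^ k + m √2⌋
  double : ∀ d x → d + (d + 2 * x) ≡ 2 * (d + x)
  double = solve-∀

√2-bits-no-long-run : ∀ b m → bitValue b + ⌊2^ 2 + m + m √2⌋ ≢ 2 ^ (2 + m) * (bitValue b + ⌊2^ m √2⌋)
√2-bits-no-long-run false m run = <⇒≱ (*-monoʳ-< 2 (⌊2^n√2⌋<2^[1+n] m))
  (⌊√s²n⌋≡s⌊√n⌋⇒s≤2⌊√n⌋ (2 ^ (2 + m)) (2 * 4 ^ m) (2*4^n-nonSquare m)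
    (trans (cong ⌊√_⌋ (sym (2*4^[k+n]≡[2^k]²*[2*4^n] (2 + m) m))) run))
√2-bits-no-long-run true m run = <⇒≱
  (1+⌊√s²n⌋≡s[1+⌊√n⌋]⇒s<2[1+⌊√n⌋] (2 ^ (2 + m)) (2 * 4 ^ m)
    (trans (cong (suc ∘ ⌊√_⌋) (sym (2*4^[k+n]≡[2^k]²*[2*4^n] (2 + m) m))) run))
  (*-monoʳ-≤ 2 (⌊2^n√2⌋<2^[1+n] m))

√2-bits-not-eventually-constant : ∀ b m → ∃ λ n → m ≤ n × √2-bit n ≢ b
√2-bits-not-eventually-constant b m with √2-bit-run b m (2 + m)
... | inj₁ change = change
... | inj₂ run    = contradiction run (√2-bits-no-long-run b m)

first-exit : ∀ {ℓ} {P : Pred ℕ ℓ} → Decidable P → ∀ {m n} → m ≤ n → P m → ¬ P n →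
             ∃ λ j → m ≤ j × P j × ¬ P (suc j)
first-exit P? {n = zero} z≤n Pm ¬Pn = contradiction Pm ¬Pn
first-exit P? {m} {suc n} m≤1+n Pm ¬P1+n
  with P? n | ≤-pred (≤∧≢⇒< m≤1+n (λ { refl → ¬P1+n Pm }))
... | yes Pn  | m≤n = n , m≤n , Pn , ¬P1+n
... | no  ¬Pn | m≤n = first-exit P? m≤n Pm ¬Pn

√2-bit-switch : ∀ b m → ∃ λ n → m ≤ n × √2-bit n ≡ b × √2-bit (suc n) ≡ not b
√2-bit-switch b m =
  let p , m≤p , bit-p≢¬b = √2-bits-not-eventually-constant (not b) m
      q , p≤q , bit-q≢b  = √2-bits-not-eventually-constant b p
      bit-p≡b            = trans (¬-not bit-p≢¬b) (not-involutive b)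
      n , p≤n , bit-n≡b , bit-1+n≢b = first-exit (λ k → √2-bit k ≟ᵇ b) p≤q bit-p≡b bit-q≢b
  in  n , ≤-trans m≤p p≤n , bit-n≡b , ¬-not bit-1+n≢b

n<4^n : ∀ n → n < 4 ^ n
n<4^n zero    = z<s
n<4^n (suc n) = ≤-<-trans (n<4^n n)
  (subst (4 ^ n <_) (*-comm (4 ^ n) 4) (m<m*n (4 ^ n) 4 {{m^n≢0 4 n}} (s≤s (s≤s z≤n))))

N≤2*4^[1+n] : ∀ {N n} → N ≤ n → N ≤ 2 * 4 ^ suc n
N≤2*4^[1+n] {N} {n} N≤n = begin
  N              ≤⟨ N≤n ⟩
  n              <⟨ n<4^n n ⟩
  4 ^ n          ≤⟨ m≤n*m (4 ^ n) 8 ⟩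
  8 * 4 ^ n      ≡⟨ *-assoc 2 4 (4 ^ n) ⟩
  2 * 4 ^ suc n  ∎
  where open ≤-Reasoning

2*4^n-good : ∀ n → Good (⌊2^ suc n √2⌋ % 4) (2 * 4 ^ n)
2*4^n-good n =
  (suc (2 * n) , cong (2 *_) (^-*-assoc 2 2 n)) , 2*4^n-nonSquare n , (m , (m²≤4q , 4q<[m+1]²) , refl)
  where
  m = ⌊2^ suc n √2⌋
  m²≤4q : m * m ≤ 4 * (2 * 4 ^ n)
  m²≤4q = subst (m * m ≤_) (2*4^[1+n]≡4*[2*4^n] n) (⌊√n⌋²≤n (2 * 4 ^ suc n))
  4q<[m+1]² : 4 * (2 * 4 ^ n) < (m + 1) * (m + 1)
  4q<[m+1]² = subst₂ _<_ (2*4^[1+n]≡4*[2*4^n] n) (cong (λ k → k * k) (+-comm 1 m))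
                (n<[1+⌊√n⌋]² (2 * 4 ^ suc n))

infinitely-many-good : ∀ b → Infinite (Good ((2 * bitValue b + bitValue (not b)) % 4))
infinitely-many-good b N = good-after-switch (√2-bit-switch b N)
  where
  r = (2 * bitValue b + bitValue (not b)) % 4
  good-after-switch : (∃ λ n → N ≤ n × √2-bit n ≡ b × √2-bit (suc n) ≡ not b) →
                      ∃ λ q → N ≤ q × Good r q
  good-after-switch (n , N≤n , bit-n≡b , bit-1+n≡¬b) =
    2 * 4 ^ suc n , N≤2*4^[1+n] N≤n , subst (λ r → Good r (2 * 4 ^ suc n)) residue (2*4^n-good (suc n))
    where
    residue : ⌊2^ 2 + n √2⌋ % 4 ≡ r
    residue = trans (⌊2^[2+n]√2⌋%4 n)
      (cong₂ (λ d₀ d₁ → (2 * bitValue d₀ + bitValue d₁) % 4) bit-n≡b bit-1+n≡¬b)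

lemma4p3 : Infinite (Good 1) × Infinite (Good 2)
lemma4p3 = infinitely-many-good false , infinitely-many-good true
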